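{- Let $n,k$ be positive integers, $q$ a prime power, and $(A_1,\ldots,A_k)$ a $k$-tuple of pairwise commuting matrices in $M_n(\mathbb{F}_q)$. For $1\le i\le k$ let $Z_i=\bigcap_{j=1}^{i}Z_{M_n(\mathbb{F}_q)}(A_j)$ (so $Z_{i+1}$ is the centralizer of $A_{i+1}$ inside $Z_i$). Then for each $1\le i\le k-1$, $Z(Z_i)\subseteq Z(Z_{i+1})$, and if $Z_{i+1}\subsetneq Z_i$ then $Z(Z_i)\subsetneq Z(Z_{i+1})$, where $Z(\cdot)$ denotes the centre of an algebra.
   Context: $Z_{M_n(\mathbb{F}_q)}(A)=\{x\in M_n(\mathbb{F}_q): xA=Ax\}$ is the centralizer algebra of $A$. -}

module Defs where

open import Level using (Level; _⊔_)
open import Algebra.Bundles using (CommutativeRing)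
open import Data.Nat using (ℕ; suc; _^_)
open import Data.Nat.Primality using (Prime)
open import Data.Fin using (Fin; zero; suc; toℕ)
open import Data.Nat using (_<_)
open import Data.Product using (Σ; ∃; _×_)
open import Relation.Nullary using (¬_)
open import Relation.Binary.PropositionalEquality using (_≡_)
import Relation.Binary.PropositionalEquality as ≡
open import Function.Bundles using (Inverse)

IsPrimePower : ℕ → Set
IsPrimePower q = Σ ℕ λ p → Σ ℕ λ m → Prime p × q ≡ p ^ suc m

IsField : ∀ {c ℓ} → CommutativeRing c ℓ → Set (c ⊔ ℓ)
IsField R = ¬ (0# ≈ 1#) × (∀ x → ¬ (x ≈ 0#) → ∃ λ y → x * y ≈ 1#)
  where open CommutativeRing R

HasCardinality : ∀ {c ℓ} → CommutativeRing c ℓ → ℕ → Set (c ⊔ ℓ)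
HasCardinality R q = Inverse (CommutativeRing.setoid R) (≡.setoid (Fin q))

module MatrixDefs {c ℓ} (R : CommutativeRing c ℓ) where
  open CommutativeRing R using (Carrier; _≈_; _+_; _*_; 0#)

  Mat : ℕ → Set c
  Mat n = Fin n → Fin n → Carrier

  ∑ : ∀ {n} → (Fin n → Carrier) → Carrier
  ∑ {ℕ.zero} f = 0#
  ∑ {suc n} f = f zero + ∑ (λ j → f (suc j))

  _·_ : ∀ {n} → Mat n → Mat n → Mat n
  (X · Y) i j = ∑ (λ l → X i l * Y l j)

  _≋_ : ∀ {n} → Mat n → Mat n → Set ℓ
  X ≋ Y = ∀ i j → X i j ≈ Y i j

  Commute : ∀ {n} → Mat n → Mat n → Set ℓ
  Commute X Y = (X · Y) ≋ (Y · X)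

  MatSet : ℕ → Set (Level.suc (c ⊔ ℓ))
  MatSet n = Mat n → Set (c ⊔ ℓ)

  _⊆_ : ∀ {n} → MatSet n → MatSet n → Set (c ⊔ ℓ)
  S ⊆ T = ∀ X → S X → T X

  _⊊_ : ∀ {n} → MatSet n → MatSet n → Set (c ⊔ ℓ)
  S ⊊ T = S ⊆ T × ∃ λ X → T X × ¬ S X

  -- Z_i = ⋂_{j=1}^{i} Z(A_j), for a k-tuple A indexed by Fin k
  -- (A_1,…,A_k correspond to A zero, …, A (k-1); so Z_i uses indices with toℕ j < i)
  Zᵢ : ∀ {n k} → (Fin k → Mat n) → ℕ → MatSet n
  Zᵢ A i X = Level.Lift (c ⊔ ℓ) (∀ (j : Fin _) → toℕ j < i → Commute X (A j))

  Centre : ∀ {n} → MatSet n → MatSet n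
  Centre S X = S X × (∀ Y → S Y → Commute X Y)

module Submission where

open import Defs
open import Level using (lift)
open import Algebra.Bundles using (CommutativeRing)
open import Data.Nat using (ℕ; suc; _≤_; _<_)
open import Data.Nat.Properties using (m<1+n⇒m<n∨m≡n; <-≤-trans; n<1+n; n≤1+n)
open import Data.Fin using (Fin; toℕ; fromℕ<)
open import Data.Fin.Properties using (toℕ-injective; toℕ-fromℕ<)
open import Data.Product using (_×_; _,_)
open import Data.Sum using (inj₁; inj₂)
open import Relation.Binary.PropositionalEquality using (subst; sym; trans)

-- A_{i+1} lies in Z_i (the A_j commute) and is central in Z_{i+1} = Z_i ∩ Z(A_{i+1}).
-- A central element of Z_i commutes with A_{i+1}, so it lies in Z_{i+1} and is central there.
-- If A_{i+1} were already central in Z_i, every element of Z_i would commute with it, giving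
-- Z_i = Z_{i+1}; so a strict inclusion Z_{i+1} ⊊ Z_i makes A_{i+1} a witness of strictness.

module _ {c ℓ} (F : CommutativeRing c ℓ) where
  open MatrixDefs F
  open CommutativeRing F using () renaming (refl to ≈-refl; sym to ≈-sym)

  Commute-refl : ∀ {n} {X : Mat n} → Commute X X
  Commute-refl _ _ = ≈-refl

  Commute-sym : ∀ {n} {X Y : Mat n} → Commute X Y → Commute Y X
  Commute-sym XY a b = ≈-sym (XY a b)

  module _ {n} {S T : MatSet n} {a : Mat n}
           (T⊆S : T ⊆ S)
           (T-commutes : ∀ Y → T Y → Commute Y a)
           (S∩Z[a]⊆T : ∀ X → S X → Commute X a → T X)
           (a∈S : S a) where

    Centre-⊆-centraliser : Centre S ⊆ Centre T
    Centre-⊆-centraliser X (X∈S , X-central) =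
      S∩Z[a]⊆T X X∈S (X-central a a∈S) , λ Y Y∈T → X-central Y (T⊆S Y Y∈T)

    ∈-Centre-centraliser : Centre T a
    ∈-Centre-centraliser =
      S∩Z[a]⊆T a a∈S Commute-refl , λ Y Y∈T → Commute-sym (T-commutes Y Y∈T)

    Centre-⊊-centraliser : T ⊊ S → Centre S ⊊ Centre T
    Centre-⊊-centraliser (_ , X , X∈S , X∉T) =
      Centre-⊆-centraliser , a , ∈-Centre-centraliser ,
      λ (_ , a-central) → X∉T (S∩Z[a]⊆T X X∈S (Commute-sym (a-central X X∈S)))

  module _ {n k} (A : Fin k → Mat n) where

    Zᵢ-antitone : ∀ {i j} → i ≤ j → Zᵢ A j ⊆ Zᵢ A i
    Zᵢ-antitone i≤j X (lift X∈Zⱼ) = lift λ l l<i → X∈Zⱼ l (<-≤-trans l<i i≤j)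

    Zᵢ-∋-commuting : (∀ j l → Commute (A j) (A l)) → ∀ i l → Zᵢ A i (A l)
    Zᵢ-∋-commuting comm i l = lift λ j _ → comm l j

    module _ {i} (i<k : i < k) where

      Zᵢ-suc-commutes : ∀ X → Zᵢ A (suc i) X → Commute X (A (fromℕ< i<k))
      Zᵢ-suc-commutes X (lift X∈Zᵢ₊₁) = X∈Zᵢ₊₁ (fromℕ< i<k) toℕ-fromℕ<-<suc
        where
        toℕ-fromℕ<-<suc : toℕ (fromℕ< i<k) < suc i
        toℕ-fromℕ<-<suc = subst (_< suc i) (sym (toℕ-fromℕ< i<k)) (n<1+n i)

      Zᵢ-suc-intro : ∀ X → Zᵢ A i X → Commute X (A (fromℕ< i<k)) → Zᵢ A (suc i) X
      Zᵢ-suc-intro X (lift X∈Zᵢ) X-commutes = lift commutes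
        where
        commutes : ∀ j → toℕ j < suc i → Commute X (A j)
        commutes j j<1+i with m<1+n⇒m<n∨m≡n j<1+i
        ... | inj₁ j<i = X∈Zᵢ j j<i
        ... | inj₂ j≡i = subst (λ l → Commute X (A l))
                               (toℕ-injective (trans (toℕ-fromℕ< i<k) (sym j≡i))) X-commutes

lemma3 : ∀ {c ℓ} (F : CommutativeRing c ℓ) → IsField F
           → (q : ℕ) → IsPrimePower q → HasCardinality F q
           → (n k : ℕ) → 1 ≤ n → 1 ≤ k
           → (A : Fin k → MatrixDefs.Mat F n)
           → (∀ j l → MatrixDefs.Commute F (A j) (A l))
           → (i : ℕ) → 1 ≤ i → i < k
           → MatrixDefs._⊆_ F (MatrixDefs.Centre F (MatrixDefs.Zᵢ F A i))
                               (MatrixDefs.Centre F (MatrixDefs.Zᵢ F A (suc i)))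
             × (MatrixDefs._⊊_ F (MatrixDefs.Zᵢ F A (suc i)) (MatrixDefs.Zᵢ F A i)
                → MatrixDefs._⊊_ F (MatrixDefs.Centre F (MatrixDefs.Zᵢ F A i))
                                    (MatrixDefs.Centre F (MatrixDefs.Zᵢ F A (suc i))))
lemma3 F _ _ _ _ n k _ _ A comm i _ i<k =
  Centre-⊆-centraliser F Zᵢ₊₁⊆Zᵢ Zᵢ₊₁-commutes Zᵢ∩Z[Aᵢ₊₁]⊆Zᵢ₊₁ Aᵢ₊₁∈Zᵢ ,
  Centre-⊊-centraliser F Zᵢ₊₁⊆Zᵢ Zᵢ₊₁-commutes Zᵢ∩Z[Aᵢ₊₁]⊆Zᵢ₊₁ Aᵢ₊₁∈Zᵢ
  where
  open MatrixDefs F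

  Aᵢ₊₁ : Mat n
  Aᵢ₊₁ = A (fromℕ< i<k)

  Zᵢ₊₁⊆Zᵢ : Zᵢ A (suc i) ⊆ Zᵢ A i
  Zᵢ₊₁⊆Zᵢ = Zᵢ-antitone F A (n≤1+n i)

  Zᵢ₊₁-commutes : ∀ Y → Zᵢ A (suc i) Y → Commute Y Aᵢ₊₁
  Zᵢ₊₁-commutes = Zᵢ-suc-commutes F A i<k

  Zᵢ∩Z[Aᵢ₊₁]⊆Zᵢ₊₁ : ∀ X → Zᵢ A i X → Commute X Aᵢ₊₁ → Zᵢ A (suc i) X
  Zᵢ∩Z[Aᵢ₊₁]⊆Zᵢ₊₁ = Zᵢ-suc-intro F A i<k

  Aᵢ₊₁∈Zᵢ : Zᵢ A i Aᵢ₊₁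
  Aᵢ₊₁∈Zᵢ = Zᵢ-∋-commuting F A comm i (fromℕ< i<k)
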